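{- Let $G$ be a $K_4$-minor-free graph and $C$ a positive integer. Every $C$-pocket of $G$ whose coboundary has size $1$ is $4$-deletable.
   Context: For an induced subgraph $H$ of $G$, the coboundary of $H$ is the set of vertices of $G - V(H)$ having a neighbour in $V(H)$. $H$ is a $C$-pocket if $H$ is a connected induced subgraph, $v(H)\le C$, and $d_G(v)\le C$ for all $v\in V(H)$. A non-empty induced subgraph $H$ of $G$ is $r$-deletable if for every list assignment $L$ of $H$ with $|L(v)|\ge r-(d_G(v)-d_H(v))$ for all $v\in V(H)$, $H$ has a proper colouring $f$ with $f(v)\in L(v)$. -}

module Defs where

open import Data.Nat using (ℕ; zero; suc; _+_; _∸_; _≤_)
open import Data.Bool using (Bool; true; false; T; not; _∧_; if_then_else_)
open import Data.Fin using (Fin)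
open import Data.List using (List; length; map; allFin)
open import Data.Nat.ListAction using (sum)
open import Data.Bool.ListAction using (any)
open import Data.Empty using (⊥)
open import Data.List.Membership.Propositional using (_∈_)
open import Data.List.Relation.Unary.Unique.Propositional using (Unique)
open import Data.Product using (Σ; _×_; ∃; ∃-syntax; _,_)
open import Relation.Binary.PropositionalEquality using (_≡_; _≢_)
open import Relation.Nullary using (¬_)

record Graph : Set where
  field
    n     : ℕ
    adj   : Fin n → Fin n → Bool
    sym   : ∀ u v → adj u v ≡ adj v u
    irrefl : ∀ v → adj v v ≡ false
open Graph public

VSet : Graph → Set
VSet G = Fin (n G) → Bool

count : ∀ {m} → (Fin m → Bool) → ℕ
count {m} P = sum (map (λ u → if P u then 1 else 0) (allFin m))

degG : (G : Graph) → Fin (n G) → ℕ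
degG G v = count (adj G v)

degH : (G : Graph) → VSet G → Fin (n G) → ℕ
degH G S v = count (λ u → adj G v u ∧ S u)

vSize : (G : Graph) → VSet G → ℕ
vSize G S = count S

data Reach (G : Graph) (S : VSet G) : Fin (n G) → Fin (n G) → Set where
  here : ∀ {u} → T (S u) → Reach G S u u
  step : ∀ {u w v} → Reach G S u w → T (adj G w v) → T (S v) → Reach G S u v

Connected : (G : Graph) → VSet G → Set
Connected G S =
  (∃[ v ] T (S v)) × (∀ u v → T (S u) → T (S v) → Reach G S u v)

inCoboundary : (G : Graph) → VSet G → Fin (n G) → Bool
inCoboundary G S u = not (S u) ∧ any (λ w → adj G u w ∧ S w) (allFin (n G))

coboundarySize : (G : Graph) → VSet G → ℕ
coboundarySize G S = count (inCoboundary G S)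

Pocket : (G : Graph) → ℕ → VSet G → Set
Pocket G C S =
  Connected G S × vSize G S ≤ C × (∀ v → T (S v) → degG G v ≤ C)

-- r-deletable (colours are natural numbers; lists are duplicate-free so
-- that length = size of the list)
Deletable : (G : Graph) → ℕ → VSet G → Set
Deletable G r S =
  (∃[ v ] T (S v)) ×
  ((L : Fin (n G) → List ℕ) →
   (∀ v → T (S v) → Unique (L v)) →
   (∀ v → T (S v) → r ∸ (degG G v ∸ degH G S v) ≤ length (L v)) →
   Σ (Fin (n G) → ℕ) λ f →
     (∀ v → T (S v) → f v ∈ L v) ×
     (∀ u v → T (S u) → T (S v) → T (adj G u v) → f u ≢ f v))

HasK4Minor : Graph → Set
HasK4Minor G =
  Σ (Fin 4 → VSet G) λ B →
    (∀ i → Connected G (B i)) ×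
    (∀ i j v → i ≢ j → T (B i v) → T (B j v) → ⊥) ×
    (∀ i j → i ≢ j → ∃[ u ] ∃[ v ] (T (B i u) × T (B j v) × T (adj G u v)))

K4MinorFree : Graph → Set
K4MinorFree G = ¬ HasK4Minor G

-- Every vertex of the pocket S has at most one neighbour outside S (the coboundary vertex),
-- so every list in the definition of 4-deletable has at least 3 colours. A K4-minor-free graph
-- is 2-degenerate, hence G[S] can be list-coloured greedily, colouring a vertex of degree at
-- most 2 last. Degeneracy is the contrapositive of: if every vertex of a non-empty set has at
-- least 3 neighbours in it, there is a K4 minor. To find it, grow a path until all neighbours of
-- its end h lie on it; let x follow h, let a be the first neighbour of h after x, and u the
-- vertex before a. Reversing the segment from h to u (Pósa rotation) gives a path of the same
-- length ending at u. Either it extends, or u has a third neighbour w: beyond a, it makes {h},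
-- x…u, {a} and the rest branch sets of a K4 minor (h has a neighbour beyond a as well); before u,
-- the first neighbour of u after its successor comes strictly earlier than a did, so the
-- rotations terminate.

module Submission where

open import Defs
open import Data.Bool using (Bool; true; false; T; not; _∧_; if_then_else_)
open import Data.Bool.Properties using (T-∧)
open import Data.Empty using (⊥; ⊥-elim)
import Data.Fin as Fin
import Data.Fin.Properties as Fin
open import Data.Fin using (Fin; suc)
open import Data.Fin.Patterns using (0F; 1F; 2F; 3F)
open import Data.List using (List; []; _∷_; [_]; _++_; _∷ʳ_; _ʳ++_; length; map; allFin; filter)
open import Data.List.Properties using (filter-notAll; ++-assoc; length-++; length-tabulate; length-map)
open import Data.List.Membership.Propositional using (_∈_; _∉_)
open import Data.List.Membership.Propositional.Properties
  using (∈-filter⁺; ∈-filter⁻; ∈-++⁺ˡ; ∈-++⁺ʳ; ∈-++⁻; ∈-allFin; ∈-map⁺)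
open import Data.List.Relation.Unary.All as All using (All; []; _∷_)
open import Data.List.Relation.Unary.All.Properties using (¬Any⇒All¬)
open import Data.List.Relation.Unary.Any as Any using (Any; here; there)
open import Data.List.Relation.Unary.Any.Properties using (any⁺)
open import Data.List.Relation.Unary.First as First using (First; _∷_) renaming (_++_∷_ to _⟨_⟩_)
import Data.List.Relation.Unary.First.Properties as First
open import Data.List.Relation.Unary.Linked using (Linked; []; [-]; _∷_)
open import Data.List.Relation.Unary.Unique.Propositional using (Unique; []; _∷_)
import Data.List.Relation.Unary.Unique.Propositional.Properties as Unique
open import Data.List.Relation.Binary.Permutation.Propositional using (↭-sym; ↭⇒↭ₛ)
open import Data.List.Relation.Binary.Permutation.Propositional.Properties
  using (++↭ʳ++; ↭-length; All-resp-↭)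
import Data.Nat as ℕ
open import Data.Nat using (ℕ; suc; _+_; _∸_; _≤_; _<_; z≤n; s≤s; _≤?_)
open import Data.Nat.Induction using (<-wellFounded)
open import Data.Nat.ListAction using (sum)
open import Data.Nat.Properties
  using (≤-refl; ≤-trans; ≤-reflexive; ≤-pred; <-≤-trans; ≮⇒≥; ≰⇒>; +-comm; +-mono-≤; +-mono-<-≤;
         +-mono-≤-<; ∸-monoʳ-<; ∸-monoʳ-≤; m≤n+o⇒m∸n≤o; +-commutativeSemigroup)
open import Algebra.Properties.CommutativeSemigroup +-commutativeSemigroup using (interchange)
open import Data.Product using (Σ; _×_; ∃; ∃-syntax; _,_; proj₁; proj₂)
open import Data.Sum using (_⊎_; inj₁; inj₂)
open import Function using (_∘_; id; Equivalence)
open import Induction.WellFounded using (Acc; acc)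
open import Relation.Binary.Definitions using (DecidableEquality; Symmetric; tri<; tri≈; tri>)
open import Relation.Binary.PropositionalEquality
  using (_≡_; _≢_; refl; cong; subst; trans; setoid) renaming (sym to ≡-sym)
open import Relation.Nullary using (¬_; Dec; yes; no; ¬?; _×-dec_)
open import Relation.Nullary.Decidable using (T?; isYes; toWitness; fromWitness; decidable-stable)

open Equivalence using (to; from)

indicator : Bool → ℕ
indicator b = if b then 1 else 0

-- count P is tally P (allFin m) by definition; over lists the counting lemmas are inductive.
tally : ∀ {A : Set} → (A → Bool) → List A → ℕ
tally P xs = sum (map (indicator ∘ P) xs)

indicator-mono : ∀ a b → (T a → T b) → indicator a ≤ indicator b
indicator-mono false b     _   = z≤n
indicator-mono true  true  _   = ≤-refl
indicator-mono true  false a⇒b = ⊥-elim (a⇒b _)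

module _ {A : Set} {P Q : A → Bool} where

  tally-mono : (∀ x → T (P x) → T (Q x)) → ∀ xs → tally P xs ≤ tally Q xs
  tally-mono P⊆Q [] = z≤n
  tally-mono P⊆Q (x ∷ xs) = +-mono-≤ (indicator-mono (P x) (Q x) (P⊆Q x)) (tally-mono P⊆Q xs)

  tally-mono-< : (∀ x → T (P x) → T (Q x)) → ∀ {d xs} → T (Q d) → ¬ T (P d) → d ∈ xs →
                 tally P xs < tally Q xs
  tally-mono-< P⊆Q {d} {_ ∷ xs} Qd ¬Pd (here refl) =
    +-mono-<-≤ (indicator-< (P d) (Q d) Qd ¬Pd) (tally-mono P⊆Q xs)
    where
    indicator-< : ∀ a b → T b → ¬ T a → indicator a < indicator b
    indicator-< false true _ _  = s≤s z≤n
    indicator-< true  _    _ ¬a = ⊥-elim (¬a _)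
  tally-mono-< P⊆Q {xs = x ∷ _} Qd ¬Pd (there d∈xs) =
    +-mono-≤-< (indicator-mono (P x) (Q x) (P⊆Q x)) (tally-mono-< P⊆Q Qd ¬Pd d∈xs)

indicator-⊎ : ∀ a b c → (T a → T b ⊎ T c) → indicator a ≤ indicator b + indicator c
indicator-⊎ false b     c     _ = z≤n
indicator-⊎ true  true  c     _ = s≤s z≤n
indicator-⊎ true  false true  _ = ≤-refl
indicator-⊎ true  false false a⇒b∨c with a⇒b∨c _
... | inj₁ ()
... | inj₂ ()

module _ {A : Set} {P Q R : A → Bool} where

  tally-⊎ : (∀ x → T (P x) → T (Q x) ⊎ T (R x)) → ∀ xs → tally P xs ≤ tally Q xs + tally R xs
  tally-⊎ P⊆Q∪R [] = z≤n
  tally-⊎ P⊆Q∪R (x ∷ xs) = ≤-trans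
    (+-mono-≤ (indicator-⊎ (P x) (Q x) (R x) (P⊆Q∪R x)) (tally-⊎ P⊆Q∪R xs))
    (≤-reflexive (interchange (indicator (Q x)) (indicator (R x)) (tally Q xs) (tally R xs)))

tally≡length-filter : ∀ {A : Set} (P : A → Bool) xs → tally P xs ≡ length (filter (T? ∘ P) xs)
tally≡length-filter P [] = refl
tally≡length-filter P (x ∷ xs) with P x
... | true  = cong suc (tally≡length-filter P xs)
... | false = tally≡length-filter P xs

module _ {A : Set} (_≟_ : DecidableEquality A) where

  open import Data.List.Membership.DecPropositional _≟_ using (_∈?_)

  pigeonhole : ∀ {xs ys : List A} → Unique xs → length ys < length xs → ∃ λ x → x ∈ xs × x ∉ ys
  pigeonhole {x ∷ xs} {ys} (x≢xs ∷ unique) |ys|<|x∷xs| with x ∈? ys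
  ... | no x∉ys = x , here refl , x∉ys
  ... | yes x∈ys with pigeonhole {xs} {ys-x} unique (<-≤-trans |ys-x|<|ys| (≤-pred |ys|<|x∷xs|))
    where
    ys-x : List A
    ys-x = filter (λ y → ¬? (y ≟ x)) ys
    |ys-x|<|ys| : length ys-x < length ys
    |ys-x|<|ys| = filter-notAll (λ y → ¬? (y ≟ x)) ys (Any.map (λ x≡y y≢x → y≢x (≡-sym x≡y)) x∈ys)
  ...   | z , z∈xs , z∉ys-x = z , there z∈xs , λ z∈ys → z∉ys-x (∈-filter⁺ (λ y → ¬? (y ≟ x)) z∈ys z≢x)
    where
    z≢x : z ≢ x
    z≢x z≡x = All.lookup x≢xs z∈xs (≡-sym z≡x)

module _ {A : Set} {R : A → A → Set} where

  Linked-++⁻ˡ : ∀ xs {ys} → Linked R (xs ++ ys) → Linked R xs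
  Linked-++⁻ˡ []           _          = []
  Linked-++⁻ˡ (x ∷ [])     _          = [-]
  Linked-++⁻ˡ (x ∷ y ∷ xs) (r ∷ rs)   = r ∷ Linked-++⁻ˡ (y ∷ xs) rs

  Linked-++⁻ʳ : ∀ xs {ys} → Linked R (xs ++ ys) → Linked R ys
  Linked-++⁻ʳ []           rs       = rs
  Linked-++⁻ʳ (x ∷ [])     [-]      = []
  Linked-++⁻ʳ (x ∷ [])     (_ ∷ rs) = rs
  Linked-++⁻ʳ (x ∷ y ∷ xs) (_ ∷ rs) = Linked-++⁻ʳ (y ∷ xs) rs

  Linked-junction : ∀ x xs {y ys} → Linked R (x ∷ xs ++ y ∷ ys) → ∃ λ z → z ∈ x ∷ xs × R z y
  Linked-junction x []        (r ∷ _)  = x , here refl , r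
  Linked-junction x (x′ ∷ xs) (_ ∷ rs) with Linked-junction x′ xs rs
  ... | z , z∈xs , r = z , there z∈xs , r

  Linked-ʳ++ : Symmetric R → ∀ {x} xs {ys} →
               Linked R (x ∷ xs) → Linked R (x ∷ ys) → Linked R (xs ʳ++ x ∷ ys)
  Linked-ʳ++ R-sym []       _        x∷ys = x∷ys
  Linked-ʳ++ R-sym (y ∷ xs) (r ∷ rs) x∷ys = Linked-ʳ++ R-sym xs rs (R-sym r ∷ x∷ys)

Unique-++⁻ʳ : ∀ {A : Set} (xs : List A) {ys} → Unique (xs ++ ys) → Unique ys
Unique-++⁻ʳ []       u       = u
Unique-++⁻ʳ (x ∷ xs) (_ ∷ u) = Unique-++⁻ʳ xs u

Unique-++⇒disjoint : ∀ {A : Set} (xs : List A) {ys v} → Unique (xs ++ ys) → v ∈ xs → v ∉ ys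
Unique-++⇒disjoint (x ∷ xs) (x≢ ∷ _) (here refl) v∈ys = All.lookup x≢ (∈-++⁺ʳ xs v∈ys) refl
Unique-++⇒disjoint (x ∷ xs) (_ ∷ u)  (there v∈xs) = Unique-++⇒disjoint xs u v∈xs

Unique⇒length≤ : ∀ {m} {xs : List (Fin m)} → Unique xs → length xs ≤ m
Unique⇒length≤ {m} {xs} unique = ≮⇒≥ λ m<|xs| →
  let x , _ , x∉allFin = pigeonhole Fin._≟_ unique (subst (_< length xs) |allFin|≡m m<|xs|)
  in x∉allFin (∈-allFin x)
  where
  |allFin|≡m : m ≡ length (allFin m)
  |allFin|≡m = ≡-sym (length-tabulate id)

∈-++-∷⁻ : ∀ {A : Set} xs {a : A} {ys w} → w ∈ xs ++ a ∷ ys → w ≢ a → w ∈ xs ⊎ w ∈ ys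
∈-++-∷⁻ xs w∈ w≢a with ∈-++⁻ xs w∈
... | inj₁ w∈xs         = inj₁ w∈xs
... | inj₂ (here w≡a)   = ⊥-elim (w≢a w≡a)
... | inj₂ (there w∈ys) = inj₂ w∈ys

ʳ++-∷-∷ : ∀ {A : Set} (h x : A) X ys →
          ∃ λ u → ∃ λ p → ∃ λ Ws →
            (h ∷ x ∷ X) ʳ++ ys ≡ u ∷ p ∷ Ws ++ ys × length Ws ≡ length X × u ∈ x ∷ X
ʳ++-∷-∷ h x []      ys = x , h , [] , refl , refl , here refl
ʳ++-∷-∷ h x (y ∷ X) ys with ʳ++-∷-∷ x y X (h ∷ ys)
... | u , p , Ws , eq , |Ws|≡|X| , u∈ =
  u , p , Ws ∷ʳ h , trans eq (cong (λ zs → u ∷ p ∷ zs) (≡-sym (++-assoc Ws [ h ] ys))) ,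
  trans (length-++ Ws) (trans (+-comm (length Ws) 1) (cong suc |Ws|≡|X|)) , there u∈

first-of-Any : ∀ {A : Set} {Q : A → Set} → (∀ x → Dec (Q x)) →
               ∀ {xs} → Any Q xs → First (¬_ ∘ Q) Q xs
first-of-Any Q? {x ∷ xs} q∈ with Q? x | q∈
... | yes qx | _          = First.[ qx ]
... | no ¬qx | here qx    = ⊥-elim (¬qx qx)
... | no ¬qx | there q∈xs = ¬qx ∷ first-of-Any Q? q∈xs

length-<-++-∷ : ∀ {A : Set} (xs : List A) {y ys} → length xs < length (xs ++ y ∷ ys)
length-<-++-∷ []       = s≤s z≤n
length-<-++-∷ (_ ∷ xs) = s≤s (length-<-++-∷ xs)

∈-∷-∷⁻ : ∀ {A : Set} {h x w : A} {R} → w ∈ h ∷ x ∷ R → w ≢ h → w ≢ x → w ∈ R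
∈-∷-∷⁻ (here w≡h)         w≢h _   = ⊥-elim (w≢h w≡h)
∈-∷-∷⁻ (there (here w≡x)) _   w≢x = ⊥-elim (w≢x w≡x)
∈-∷-∷⁻ (there (there w∈R)) _  _   = w∈R

from-ordered-pairs : ∀ {k} (R : Fin k → Fin k → Set) → (∀ {i j} → R i j → R j i) →
                     (∀ {i j} → i Fin.< j → R i j) → ∀ i j → i ≢ j → R i j
from-ordered-pairs R R-sym R-< i j i≢j with Fin.<-cmp i j
... | tri< i<j _ _ = R-< i<j
... | tri≈ _ i≡j _ = ⊥-elim (i≢j i≡j)
... | tri> _ _ j<i = R-sym (R-< j<i)

Fin4-<-elim : (R : Fin 4 → Fin 4 → Set) →
              R 0F 1F → R 0F 2F → R 0F 3F → R 1F 2F → R 1F 3F → R 2F 3F → ∀ {i j} → i Fin.< j → R i j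
Fin4-<-elim R r₀₁ r₀₂ r₀₃ r₁₂ r₁₃ r₂₃ {0F} {1F} _ = r₀₁
Fin4-<-elim R r₀₁ r₀₂ r₀₃ r₁₂ r₁₃ r₂₃ {0F} {2F} _ = r₀₂
Fin4-<-elim R r₀₁ r₀₂ r₀₃ r₁₂ r₁₃ r₂₃ {0F} {3F} _ = r₀₃
Fin4-<-elim R r₀₁ r₀₂ r₀₃ r₁₂ r₁₃ r₂₃ {1F} {2F} _ = r₁₂
Fin4-<-elim R r₀₁ r₀₂ r₀₃ r₁₂ r₁₃ r₂₃ {1F} {3F} _ = r₁₃
Fin4-<-elim R r₀₁ r₀₂ r₀₃ r₁₂ r₁₃ r₂₃ {2F} {3F} _ = r₂₃
Fin4-<-elim R _ _ _ _ _ _ {1F}                {1F} (s≤s ())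
Fin4-<-elim R _ _ _ _ _ _ {suc (suc _)}       {1F} (s≤s ())
Fin4-<-elim R _ _ _ _ _ _ {suc (suc _)}       {2F} (s≤s (s≤s ()))
Fin4-<-elim R _ _ _ _ _ _ {suc (suc (suc _))} {3F} (s≤s (s≤s (s≤s ())))

module _ (G : Graph) where

  open import Data.List.Relation.Binary.Permutation.Setoid.Properties (setoid (Fin (n G)))
    using (Unique-resp-↭)

  open import Data.List.Membership.DecPropositional (Fin._≟_ {n G}) using (_∈?_)

  Vertex : Set
  Vertex = Fin (n G)

  _~_ : Vertex → Vertex → Set
  u ~ v = T (adj G u v)

  ~-sym : Symmetric _~_
  ~-sym {u} {v} = subst T (Graph.sym G u v)

  ~-irrefl : ∀ {v} → ¬ v ~ v
  ~-irrefl {v} = subst T (irrefl G v)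

  module _ {B : VSet G} where

    Reach-end : ∀ {u v} → Reach G B u v → T (B v)
    Reach-end (here b)     = b
    Reach-end (step _ _ b) = b

    Reach-trans : ∀ {u w v} → Reach G B u w → Reach G B w v → Reach G B u v
    Reach-trans r (here _)      = r
    Reach-trans r (step r′ e b) = step (Reach-trans r r′) e b

    Reach-sym : ∀ {u v} → Reach G B u v → Reach G B v u
    Reach-sym (here b)     = here b
    Reach-sym (step r e b) = Reach-trans (step (here b) (~-sym e) (Reach-end r)) (Reach-sym r)

    Linked⇒Reach : ∀ {x xs} → Linked _~_ (x ∷ xs) → All (T ∘ B) (x ∷ xs) →
                   ∀ {v} → v ∈ x ∷ xs → Reach G B x v
    Linked⇒Reach _        (bx ∷ _)   (here refl)  = here bx
    Linked⇒Reach (e ∷ es) (bx ∷ bxs) (there v∈xs) =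
      Reach-trans (step (here bx) e (All.head bxs)) (Linked⇒Reach es bxs v∈xs)

  members : List Vertex → VSet G
  members xs v = isYes (v ∈? xs)

  ∈⇒members : ∀ {v xs} → v ∈ xs → T (members xs v)
  ∈⇒members {v} {xs} = fromWitness {a? = v ∈? xs}

  members⇒∈ : ∀ {v xs} → T (members xs v) → v ∈ xs
  members⇒∈ {v} {xs} = toWitness {a? = v ∈? xs}

  Linked⇒Connected : ∀ {x xs} → Linked _~_ (x ∷ xs) → Connected G (members (x ∷ xs))
  Linked⇒Connected {x} {xs} linked =
    (x , ∈⇒members (here refl)) ,
    λ u v u∈ v∈ → Reach-trans (Reach-sym (reach (members⇒∈ u∈))) (reach (members⇒∈ v∈))
    where
    reach : ∀ {v} → v ∈ x ∷ xs → Reach G (members (x ∷ xs)) x v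
    reach = Linked⇒Reach linked (All.tabulate ∈⇒members)

  Touch : List Vertex → List Vertex → Set
  Touch xs ys = ∃ λ u → ∃ λ v → u ∈ xs × v ∈ ys × u ~ v

  Touch-sym : ∀ {xs ys} → Touch xs ys → Touch ys xs
  Touch-sym (u , v , u∈ , v∈ , u~v) = v , u , v∈ , u∈ , ~-sym u~v

  chords⇒K4Minor : ∀ {x₀ x₁ x₂ x₃ xs₀ xs₁ xs₂ xs₃} →
    let P₀ = x₀ ∷ xs₀ ; P₁ = x₁ ∷ xs₁ ; P₂ = x₂ ∷ xs₂ ; P₃ = x₃ ∷ xs₃ in
    Linked _~_ (P₀ ++ P₁ ++ P₂ ++ P₃) → Unique (P₀ ++ P₁ ++ P₂ ++ P₃) →
    Touch P₀ P₂ → Touch P₀ P₃ → Touch P₁ P₃ → HasK4Minor G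
  chords⇒K4Minor {x₀} {x₁} {x₂} {x₃} {xs₀} {xs₁} {xs₂} {xs₃} linked unique t₀₂ t₀₃ t₁₃ =
    members ∘ P , connected , disjoint , adjacent
    where
    P : Fin 4 → List Vertex
    P 0F = x₀ ∷ xs₀
    P 1F = x₁ ∷ xs₁
    P 2F = x₂ ∷ xs₂
    P 3F = x₃ ∷ xs₃

    linked₁₂₃ : Linked _~_ (P 1F ++ P 2F ++ P 3F)
    linked₁₂₃ = Linked-++⁻ʳ (P 0F) linked
    linked₂₃ : Linked _~_ (P 2F ++ P 3F)
    linked₂₃ = Linked-++⁻ʳ (P 1F) linked₁₂₃
    unique₁₂₃ : Unique (P 1F ++ P 2F ++ P 3F)
    unique₁₂₃ = Unique-++⁻ʳ (P 0F) unique
    unique₂₃ : Unique (P 2F ++ P 3F)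
    unique₂₃ = Unique-++⁻ʳ (P 1F) unique₁₂₃

    connected : ∀ i → Connected G (members (P i))
    connected 0F = Linked⇒Connected (Linked-++⁻ˡ (P 0F) linked)
    connected 1F = Linked⇒Connected (Linked-++⁻ˡ (P 1F) linked₁₂₃)
    connected 2F = Linked⇒Connected (Linked-++⁻ˡ (P 2F) linked₂₃)
    connected 3F = Linked⇒Connected (Linked-++⁻ʳ (P 2F) linked₂₃)

    Apart : Fin 4 → Fin 4 → Set
    Apart i j = ∀ {v} → v ∈ P i → v ∉ P j

    Apart-++ : ∀ xs {ys zs} → Unique (xs ++ ys) → (∀ {v} → v ∈ zs → v ∈ ys) →
               ∀ {v} → v ∈ xs → v ∉ zs
    Apart-++ xs unique zs⊆ys v∈xs = Unique-++⇒disjoint xs unique v∈xs ∘ zs⊆ys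

    apart : ∀ {i j} → i Fin.< j → Apart i j
    apart = Fin4-<-elim Apart
      (Apart-++ (P 0F) unique ∈-++⁺ˡ)
      (Apart-++ (P 0F) unique (∈-++⁺ʳ (P 1F) ∘ ∈-++⁺ˡ))
      (Apart-++ (P 0F) unique (∈-++⁺ʳ (P 1F) ∘ ∈-++⁺ʳ (P 2F)))
      (Apart-++ (P 1F) unique₁₂₃ ∈-++⁺ˡ)
      (Apart-++ (P 1F) unique₁₂₃ (∈-++⁺ʳ (P 2F)))
      (Apart-++ (P 2F) unique₂₃ (λ v∈ → v∈))

    junction : ∀ {x xs y ys zs} → Linked _~_ (x ∷ xs ++ y ∷ zs) → Touch (x ∷ xs) (y ∷ ys)
    junction {x} {xs} {y} xs~ys with Linked-junction x xs xs~ys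
    ... | u , u∈ , u~y = u , y , u∈ , here refl , u~y

    touch : ∀ {i j} → i Fin.< j → Touch (P i) (P j)
    touch = Fin4-<-elim (λ i j → Touch (P i) (P j))
      (junction linked) t₀₂ t₀₃ (junction linked₁₂₃) t₁₃ (junction linked₂₃)

    disjoint : ∀ i j v → i ≢ j → T (members (P i) v) → T (members (P j) v) → ⊥
    disjoint i j v i≢j v∈i v∈j =
      from-ordered-pairs Apart (λ apart v∈i v∈j → apart v∈j v∈i) apart i j i≢j (members⇒∈ v∈i) (members⇒∈ v∈j)

    adjacent : ∀ i j → i ≢ j → ∃[ u ] ∃[ v ] (T (members (P i) u) × T (members (P j) v) × u ~ v)
    adjacent i j i≢j with from-ordered-pairs (λ i j → Touch (P i) (P j)) Touch-sym touch i j i≢j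
    ... | u , v , u∈ , v∈ , u~v = u , v , ∈⇒members u∈ , ∈⇒members v∈ , u~v

  -- The branch sets are {h}, x ∷ X, {a} and Y.
  crossing-chords⇒K4Minor : ∀ {h x X a Y b u w} →
    Linked _~_ (h ∷ x ∷ X ++ a ∷ Y) → Unique (h ∷ x ∷ X ++ a ∷ Y) →
    h ~ a → b ∈ Y → h ~ b → u ∈ x ∷ X → w ∈ Y → u ~ w → HasK4Minor G
  crossing-chords⇒K4Minor {h} {a = a} {Y = _ ∷ _} {b} {u} {w} linked unique h~a b∈Y h~b u∈ w∈Y u~w =
    chords⇒K4Minor {xs₀ = []} {xs₂ = []} linked unique
      (h , a , here refl , here refl , h~a) (h , b , here refl , b∈Y , h~b) (u , w , u∈ , w∈Y , u~w)

  module MinimumDegreeThree (S : VSet G) (δ≥3 : ∀ v → T (S v) → 3 ≤ degH G S v) where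

    Nbr : Vertex → Vertex → Set
    Nbr v w = T (adj G v w ∧ S w)

    Nbr⇒~ : ∀ {v w} → Nbr v w → v ~ w
    Nbr⇒~ = proj₁ ∘ to T-∧

    Nbr⇒≢ : ∀ {v w} → Nbr v w → w ≢ v
    Nbr⇒≢ vw refl = ~-irrefl (Nbr⇒~ vw)

    neighbour-outside : ∀ {v} → T (S v) → (F : List Vertex) → length F ≤ 2 → ∃ λ w → Nbr v w × w ∉ F
    neighbour-outside {v} v∈S F |F|≤2 =
      let w , w∈nbrs , w∉F = pigeonhole Fin._≟_ (Unique.filter⁺ (T? ∘ nbr) (Unique.allFin⁺ (n G))) |F|<|nbrs|
      in w , proj₂ (∈-filter⁻ (T? ∘ nbr) {xs = allFin (n G)} w∈nbrs) , w∉F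
      where
      nbr : Vertex → Bool
      nbr u = adj G v u ∧ S u
      |F|<|nbrs| : length F < length (filter (T? ∘ nbr) (allFin (n G)))
      |F|<|nbrs| = ≤-trans (s≤s |F|≤2) (subst (3 ≤_) (tally≡length-filter nbr (allFin (n G))) (δ≥3 v v∈S))

    record IsPath (P : List Vertex) : Set where
      field
        linked : Linked _~_ P
        unique : Unique P
        inS    : All (T ∘ S) P
    open IsPath

    IsPath-∷ : ∀ {v P w} → IsPath (v ∷ P) → Nbr v w → w ∉ v ∷ P → IsPath (w ∷ v ∷ P)
    IsPath-∷ path vw w∉ = record
      { linked = ~-sym (Nbr⇒~ vw) ∷ linked path
      ; unique = ¬Any⇒All¬ _ w∉ ∷ unique path
      ; inS    = proj₂ (to T-∧ vw) ∷ inS path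
      }

    IsPath-rotate : ∀ {h Z a Y} → IsPath (h ∷ Z ++ a ∷ Y) → h ~ a → IsPath ((h ∷ Z) ʳ++ a ∷ Y)
    IsPath-rotate {h} {Z} {a} {Y} path h~a = record
      { linked = Linked-ʳ++ ~-sym Z (Linked-++⁻ˡ (h ∷ Z) (linked path))
                                    (h~a ∷ Linked-++⁻ʳ (h ∷ Z) (linked path))
      ; unique = Unique-resp-↭ (↭⇒↭ₛ (++↭ʳ++ (h ∷ Z) (a ∷ Y))) (unique path)
      ; inS    = All-resp-↭ (++↭ʳ++ (h ∷ Z) (a ∷ Y)) (inS path)
      }

    Saturated : Vertex → List Vertex → Set
    Saturated v P = ∀ {w} → Nbr v w → w ∈ P

    SaturatedPath : ℕ → Vertex → List Vertex → Set
    SaturatedPath ℓ h R = IsPath (h ∷ R) × Saturated h (h ∷ R) × length (h ∷ R) ≡ ℓ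

    LongerPath : ℕ → Set
    LongerPath ℓ = ∃ λ w → ∃ λ P → IsPath (w ∷ P) × ℓ < length (w ∷ P)

    saturated-or-longer : ∀ {v P} → IsPath (v ∷ P) → Saturated v (v ∷ P) ⊎ LongerPath (length (v ∷ P))
    saturated-or-longer {v} {P} path with Fin.any? (λ w → T? (adj G v w ∧ S w) ×-dec ¬? (w ∈? v ∷ P))
    ... | yes (w , vw , w∉) = inj₂ (w , v ∷ P , IsPath-∷ path vw w∉ , ≤-refl)
    ... | no saturated      =
      inj₁ λ {w} vw → decidable-stable (w ∈? v ∷ P) (λ w∉ → saturated (w , vw , w∉))

    record FirstReturn (ℓ : ℕ) : Set where
      field
        h x a          : Vertex
        X Y            : List Vertex
        saturated-path : SaturatedPath ℓ h (x ∷ X ++ a ∷ Y)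
        returns        : h ~ a
        avoids         : All (λ y → ¬ h ~ y) X

    first-return : ∀ {ℓ h R} → SaturatedPath ℓ h R → FirstReturn ℓ
    first-return {h = h} {[]} (path , saturated , _) with neighbour-outside (All.head (inS path)) [] z≤n
    ... | w , hw , _ with saturated hw
    ...   | here w≡h = ⊥-elim (Nbr⇒≢ hw w≡h)
    first-return {h = h} {x ∷ R} sp@(path , saturated , _)
      with neighbour-outside (All.head (inS path)) (x ∷ []) (s≤s z≤n)
    ... | w , hw , w∉x
      with First.toView (first-of-Any (λ y → T? (adj G h y))
             (Any.map (λ { refl → Nbr⇒~ hw }) (∈-∷-∷⁻ (saturated hw) (Nbr⇒≢ hw) (w∉x ∘ here))))
    ...   | avoids ⟨ h~a ⟩ Y = record
      { h = h ; x = x ; a = _ ; X = _ ; Y = Y ; saturated-path = sp ; returns = h~a ; avoids = avoids }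

    neighbour-after-return : ∀ {ℓ} (r : FirstReturn ℓ) → ∃ λ b → b ∈ FirstReturn.Y r × FirstReturn.h r ~ b
    neighbour-after-return
      (record { x = x ; X = X ; a = a ; saturated-path = path , saturated , _ ; avoids = avoids })
      with neighbour-outside (All.head (inS path)) (x ∷ a ∷ []) ≤-refl
    ... | b , hb , b∉
      with ∈-++-∷⁻ X (∈-∷-∷⁻ (saturated hb) (Nbr⇒≢ hb) (b∉ ∘ here)) (b∉ ∘ there ∘ here)
    ...   | inj₁ b∈X = ⊥-elim (All.lookup avoids b∈X (Nbr⇒~ hb))
    ...   | inj₂ b∈Y = b , b∈Y , Nbr⇒~ hb

    -- Pósa rotation: u ∷ p ∷ Ws is h ∷ x ∷ X reversed, attached to a through the chord h ~ a.
    rotation : ∀ {h x X a Y} → IsPath (h ∷ x ∷ X ++ a ∷ Y) → h ~ a →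
               ∃ λ u → ∃ λ p → ∃ λ Ws → IsPath (u ∷ p ∷ Ws ++ a ∷ Y) ×
               length (u ∷ p ∷ Ws ++ a ∷ Y) ≡ length (h ∷ x ∷ X ++ a ∷ Y) ×
               length Ws ≡ length X × u ∈ x ∷ X
    rotation {h} {x} {X} {a} {Y} path h~a =
      let u , p , Ws , rotated≡ , |Ws|≡|X| , u∈ = ʳ++-∷-∷ h x X (a ∷ Y)
      in u , p , Ws , subst IsPath rotated≡ (IsPath-rotate {Z = x ∷ X} {Y = Y} path h~a) ,
         trans (cong length (≡-sym rotated≡)) (↭-length (↭-sym (++↭ʳ++ (h ∷ x ∷ X) (a ∷ Y)))) ,
         |Ws|≡|X| , u∈

    rotate : ∀ {ℓ} (r : FirstReturn ℓ) →
             HasK4Minor G ⊎ LongerPath ℓ ⊎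
             Σ (FirstReturn ℓ) λ r′ → length (FirstReturn.X r′) < length (FirstReturn.X r)
    rotate r@(record { h = h ; x = x ; X = X ; a = a ; Y = Y ; saturated-path = path , _ , refl ; returns = h~a })
      with rotation path h~a
    ... | u , p , Ws , path′ , |path′|≡ , |Ws|≡|X| , u∈ with saturated-or-longer path′
    ... | inj₂ longer = inj₂ (inj₁ (subst LongerPath |path′|≡ longer))
    ... | inj₁ saturated′ with neighbour-outside (All.head (inS path′)) (p ∷ a ∷ []) ≤-refl
    ...   | w , uw , w∉
      with ∈-++-∷⁻ Ws (∈-∷-∷⁻ (saturated′ uw) (Nbr⇒≢ uw) (w∉ ∘ here)) (w∉ ∘ there ∘ here)
    ...     | inj₂ w∈Y =
      let b , b∈Y , h~b = neighbour-after-return r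
      in inj₁ (crossing-chords⇒K4Minor (linked path) (unique path) h~a b∈Y h~b u∈ w∈Y (Nbr⇒~ uw))
    ...     | inj₁ w∈Ws
      with First.toView (first-of-Any (λ y → T? (adj G u y)) (Any.map (λ { refl → Nbr⇒~ uw }) w∈Ws))
    ...       | avoids′ ⟨ u~a′ ⟩ Y′ = inj₂ (inj₂ (r′ , shorter))
      where
      r′ : FirstReturn (length (h ∷ x ∷ X ++ a ∷ Y))
      r′ = record
        { h = u ; x = p ; a = _ ; X = _ ; Y = Y′ ++ a ∷ Y
        ; saturated-path = subst (SaturatedPath _ u ∘ (p ∷_)) (++-assoc _ (_ ∷ Y′) (a ∷ Y))
                                 (path′ , saturated′ , |path′|≡)
        ; returns = u~a′ ; avoids = avoids′ }
      shorter : length (FirstReturn.X r′) < length X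
      shorter = subst (length (FirstReturn.X r′) <_) |Ws|≡|X| (length-<-++-∷ (FirstReturn.X r′))

    rotate-until-done : ∀ {ℓ} (r : FirstReturn ℓ) → Acc _<_ (length (FirstReturn.X r)) →
                        HasK4Minor G ⊎ LongerPath ℓ
    rotate-until-done r (acc smaller) with rotate r
    ... | inj₁ K4              = inj₁ K4
    ... | inj₂ (inj₁ longer)   = inj₂ longer
    ... | inj₂ (inj₂ (r′ , <)) = rotate-until-done r′ (smaller <)

    K4-or-longer : ∀ {v P} → IsPath (v ∷ P) → HasK4Minor G ⊎ LongerPath (length (v ∷ P))
    K4-or-longer path with saturated-or-longer path
    ... | inj₁ saturated = rotate-until-done (first-return (path , saturated , refl)) (<-wellFounded _)
    ... | inj₂ longer    = inj₂ longer

    grow : ∀ {v P} → IsPath (v ∷ P) → Acc _<_ (n G ∸ length (v ∷ P)) → HasK4Minor G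
    grow path (acc smaller) with K4-or-longer path
    ... | inj₁ K4                       = K4
    ... | inj₂ (_ , _ , path′ , longer) =
      grow path′ (smaller (∸-monoʳ-< longer (Unique⇒length≤ (unique path′))))

    nonempty⇒K4Minor : ∀ {v} → T (S v) → HasK4Minor G
    nonempty⇒K4Minor v∈S =
      grow (record { linked = [-] ; unique = [] ∷ [] ; inS = v∈S ∷ [] }) (<-wellFounded _)

  remove : VSet G → Vertex → VSet G
  remove R d u = R u ∧ not (isYes (u Fin.≟ d))

  remove-⊆ : ∀ {R d u} → T (remove R d u) → T (R u)
  remove-⊆ = proj₁ ∘ to T-∧

  remove-keeps : ∀ {R d u} → T (R u) → u ≢ d → T (remove R d u)
  remove-keeps {d = d} {u} u∈R u≢d with u Fin.≟ d
  ... | yes u≡d = ⊥-elim (u≢d u≡d)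
  ... | no  _   = from T-∧ (u∈R , _)

  remove-drops : ∀ {R d} → ¬ T (remove R d d)
  remove-drops {d = d} d∈ with d Fin.≟ d
  ... | yes _   = proj₂ (to T-∧ d∈)
  ... | no  d≢d = d≢d refl

  update : (Vertex → ℕ) → Vertex → ℕ → Vertex → ℕ
  update f d c u = if isYes (u Fin.≟ d) then c else f u

  ListColouring : VSet G → (Vertex → List ℕ) → (Vertex → ℕ) → Set
  ListColouring R L f =
    (∀ v → T (R v) → f v ∈ L v) × (∀ u v → T (R u) → T (R v) → u ~ v → f u ≢ f v)

  extend-colouring : ∀ {R L f d c} → ListColouring (remove R d) L f → c ∈ L d →
                     (∀ {u} → T (R u) → d ~ u → f u ≢ c) → ListColouring R L (update f d c)
  extend-colouring {R} {L} {f} {d} {c} (f∈L , proper) c∈L c-free = update∈L , update-proper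
    where
    update∈L : ∀ v → T (R v) → update f d c v ∈ L v
    update∈L v v∈R with v Fin.≟ d
    ... | yes refl = c∈L
    ... | no  v≢d  = f∈L v (remove-keeps {R} v∈R v≢d)

    update-proper : ∀ u v → T (R u) → T (R v) → u ~ v → update f d c u ≢ update f d c v
    update-proper u v u∈R v∈R u~v with u Fin.≟ d | v Fin.≟ d
    ... | yes refl | yes refl = ⊥-elim (~-irrefl u~v)
    ... | yes refl | no  _    = c-free v∈R u~v ∘ ≡-sym
    ... | no  _    | yes refl = c-free u∈R (~-sym u~v)
    ... | no  u≢d  | no  v≢d  = proper u v (remove-keeps {R} u∈R u≢d) (remove-keeps {R} v∈R v≢d) u~v

  Degenerate : ℕ → Set
  Degenerate k = ∀ (R : VSet G) → ∃[ v ] T (R v) → ∃[ d ] T (R d) × degH G R d ≤ k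

  K4MinorFree⇒2-degenerate : K4MinorFree G → Degenerate 2
  K4MinorFree⇒2-degenerate K4-free R (v , v∈R) with Fin.any? (λ d → T? (R d) ×-dec (degH G R d ≤? 2))
  ... | yes low = low
  ... | no  none = ⊥-elim (K4-free (MinimumDegreeThree.nonempty⇒K4Minor R δ≥3 v∈R))
    where
    δ≥3 : ∀ d → T (R d) → 3 ≤ degH G R d
    δ≥3 d d∈R = ≰⇒> λ ≤2 → none (d , d∈R , ≤2)

  degenerate⇒choosable : ∀ {k} → Degenerate k → (S : VSet G) (L : Vertex → List ℕ) →
                         (∀ v → T (S v) → Unique (L v)) → (∀ v → T (S v) → suc k ≤ length (L v)) →
                         Σ (Vertex → ℕ) (ListColouring S L)
  degenerate⇒choosable {k} degenerate S L unique long = colour S (λ v∈S → v∈S) (<-wellFounded (count S))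
    where
    free-colour : ∀ {R d} (f : Vertex → ℕ) → T (S d) → degH G R d ≤ k →
                  ∃ λ c → c ∈ L d × ∀ {u} → T (R u) → d ~ u → f u ≢ c
    free-colour {R} {d} f d∈S low =
      let c , c∈L , c∉used = pigeonhole ℕ._≟_ (unique d d∈S) (<-≤-trans (s≤s |used|≤k) (long d d∈S))
      in c , c∈L , λ u∈R d~u fu≡c → c∉used (subst (_∈ used) fu≡c (∈-map⁺ f (neighbour∈nbrs u∈R d~u)))
      where
      nbr : Vertex → Bool
      nbr u = adj G d u ∧ R u
      nbrs : List Vertex
      nbrs = filter (T? ∘ nbr) (allFin (n G))
      neighbour∈nbrs : ∀ {u} → T (R u) → d ~ u → u ∈ nbrs
      neighbour∈nbrs u∈R d~u = ∈-filter⁺ (T? ∘ nbr) (∈-allFin _) (from T-∧ (d~u , u∈R))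
      used : List ℕ
      used = map f nbrs
      |used|≤k : length used ≤ k
      |used|≤k = subst (_≤ k) (trans (tally≡length-filter nbr (allFin (n G))) (≡-sym (length-map f nbrs))) low

    colour : (R : VSet G) → (∀ {v} → T (R v) → T (S v)) → Acc _<_ (count R) →
             Σ (Vertex → ℕ) (ListColouring R L)
    colour R R⊆S (acc smaller) with Fin.any? (T? ∘ R)
    ... | no  empty    =
      (λ _ → 0) , (λ v v∈R → ⊥-elim (empty (v , v∈R))) , (λ u _ u∈R → ⊥-elim (empty (u , u∈R)))
    ... | yes nonempty =
      let d , d∈R , low = degenerate R nonempty
          smaller-R = tally-mono-< (λ _ → remove-⊆ {R}) d∈R (remove-drops {R}) (∈-allFin d)
          f , f-colours = colour (remove R d) (R⊆S ∘ remove-⊆ {R}) (smaller smaller-R)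
          c , c∈L , c-free = free-colour f (R⊆S d∈R) low
      in update f d c , extend-colouring f-colours c∈L c-free

  degree≤inner-degree+coboundary : (S : VSet G) → ∀ {v} → T (S v) →
                                   degG G v ≤ degH G S v + coboundarySize G S
  degree≤inner-degree+coboundary S {v} v∈S = tally-⊎ inside-or-coboundary (allFin (n G))
    where
    inside-or-coboundary : ∀ u → T (adj G v u) → T (adj G v u ∧ S u) ⊎ T (inCoboundary G S u)
    inside-or-coboundary u v~u with S u
    ... | true  = inj₁ (from T-∧ (v~u , _))
    ... | false = inj₂ (any⁺ _ (Any.map (λ { refl → from T-∧ (~-sym v~u , v∈S) }) (∈-allFin v)))

mainTheorem10 : (G : Graph) → K4MinorFree G → (C : ℕ) → 1 ≤ C →
    (S : VSet G) → Pocket G C S → coboundarySize G S ≡ 1 →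
    Deletable G 4 S
mainTheorem10 G K4-free _ _ S ((nonempty , _) , _) |∂S|≡1 =
  nonempty , λ L unique long →
    degenerate⇒choosable G (K4MinorFree⇒2-degenerate G K4-free) S L unique (three-colours L long)
  where
  outer-degree≤1 : ∀ {v} → T (S v) → degG G v ∸ degH G S v ≤ 1
  outer-degree≤1 {v} v∈S = m≤n+o⇒m∸n≤o (degG G v) (degH G S v)
    (subst (degG G v ≤_) (cong (degH G S v +_) |∂S|≡1) (degree≤inner-degree+coboundary G S v∈S))
  three-colours : ∀ L → (∀ v → T (S v) → 4 ∸ (degG G v ∸ degH G S v) ≤ length (L v)) →
                  ∀ v → T (S v) → 3 ≤ length (L v)
  three-colours L long v v∈S = ≤-trans (∸-monoʳ-≤ 4 (outer-degree≤1 v∈S)) (long v v∈S)
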